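{- Let $H$ be a spanning subgraph of the complete bipartite graph $K_{m,m}$ with $|E(H)|<\frac{m}{4}$. Then the number of perfect matchings in $K_{m,m}\setminus H$ is at least $$\left(1-O\left(\frac{|E(H)|^2}{m^2}\right)\right)\cdot m!\cdot e^{ -|E(H)|/m},$$ where the implied constant in the $O(\cdot)$ is absolute.
   Context: $K_{m,m}\setminus H$ denotes the graph on the vertex set of $K_{m,m}$ whose edges are those of $K_{m,m}$ not in $H$; $|E(H)|$ is the number of edges of $H$. -}

module Defs where

open import Data.Bool using (Bool; true; false; not; _∧_; _∨_)
open import Data.Nat as ℕ using (ℕ; zero; suc)
open import Data.Nat using (_!)
open import Data.Nat.Properties using (_!≢0)
open import Data.Nat.ListAction using (sum)
open import Data.Fin using (Fin; _≟_)
open import Data.Vec using (Vec; []; _∷_)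
open import Data.List as L using (List; []; _∷_; concatMap; map; length; filterᵇ; allFin)
open import Data.Integer using (+_)
open import Data.Rational using (ℚ; _/_; 0ℚ; 1ℚ; _+_; _*_)
open import Relation.Nullary.Decidable using (⌊_⌋)

-- A spanning subgraph H of K_{m,m} (left part and right part both Fin m)
-- is given by its edge set: H i j = true iff the edge {left i, right j} is in H.
BipGraph : ℕ → Set
BipGraph m = Fin m → Fin m → Bool

countFin : ∀ {m} → (Fin m → Bool) → ℕ
countFin {m} p = length (filterᵇ p (allFin m))

numEdges : ∀ {m} → BipGraph m → ℕ
numEdges {m} H = sum (map (λ i → countFin (H i)) (allFin m))

allVecs : (n k : ℕ) → List (Vec (Fin k) n)
allVecs zero    k = [] ∷ []
allVecs (suc n) k = concatMap (λ v → map (λ a → a ∷ v) (allFin k)) (allVecs n k)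

elemᵇ : ∀ {k n} → Fin k → Vec (Fin k) n → Bool
elemᵇ a []       = false
elemᵇ a (b ∷ v)  = ⌊ a ≟ b ⌋ ∨ elemᵇ a v

distinctᵇ : ∀ {k n} → Vec (Fin k) n → Bool
distinctᵇ []      = true
distinctᵇ (a ∷ v) = not (elemᵇ a v) ∧ distinctᵇ v

-- the matching i ↦ σ i (left vertex i, right vertex σ i) uses no edge of H
-- (index of a vector entry is its left vertex)
avoidsᵇ : ∀ {m n} → (Fin n → Fin m → Bool) → Vec (Fin m) n → Bool
avoidsᵇ H []      = true
avoidsᵇ H (a ∷ v) = not (H Data.Fin.zero a) ∧ avoidsᵇ (λ i → H (Data.Fin.suc i)) v

-- number of perfect matchings of K_{m,m} \ H:
-- bijections σ : Fin m → Fin m with (i, σ i) ∉ E(H) for all i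
numPerfectMatchings : ∀ {m} → BipGraph m → ℕ
numPerfectMatchings {m} H =
  length (filterᵇ (λ v → distinctᵇ v ∧ avoidsᵇ H v) (allVecs m m))

toℚ : ℕ → ℚ
toℚ n = + n / 1

pow : ℚ → ℕ → ℚ
pow x zero    = 1ℚ
pow x (suc n) = x * pow x n

-- partial sums S_N(x) = Σ_{n=0}^{N} x^n / n! of the exponential series;
-- e^x = sup_N S_N(x) for x ≥ 0
expPartial : ℕ → ℚ → ℚ
expPartial zero    x = 1ℚ
expPartial (suc N) x = expPartial N x + pow x (suc N) * (+ 1 / (suc N !))
  where instance _ = (suc N) !≢0

-- Perfect matchings of K_{m,m} are the permutations σ of Fin m, and σ fails to
-- be a matching of K_{m,m} \ H only if σ i = a for some edge (i, a) of H; each such condition is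
-- met by exactly (m - 1)! permutations. Hence PM ≥ m! - |E(H)|·(m - 1)! = (1 - x)·m! with
-- x = |E(H)|/m, and since e^x is bounded below by its partial sum 1 + x,
-- PM·(1 + x) ≥ (1 - x)(1 + x)·m! = (1 - x²)·m!.
--
-- Permutations are counted as duplicate-free vectors: the injections Fin n → Fin k number
-- k P′ n = k (k - 1) ⋯ (k - n + 1), because a vector of n distinct values extends on the left
-- in exactly k ∸ n ways; the injections with a prescribed value at a prescribed position number
-- (k - 1) P′ (n - 1) by the same induction.

module Submission where

module Injections where

  open import Algebra.Bundles using (CommutativeMonoid)
  import Algebra.Properties.CommutativeSemigroup as CommSemigroupProperties
  open import Data.Bool using (Bool; true; false; not; _∧_; _∨_)
  open import Data.Bool.Properties
    using (∧-assoc; ∧-comm; ∧-identityʳ; ∧-commutativeMonoid; ∨-∧-booleanAlgebra)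
  open import Algebra.Lattice.Properties.BooleanAlgebra ∨-∧-booleanAlgebra using (deMorgan₂)
  open import Data.Fin using (Fin; zero; suc; _≟_)
  open import Data.List using (List; []; _∷_; _++_; map; concatMap; length; filterᵇ; allFin)
  open import Data.List.Properties using (map-++; map-∘; map-tabulate)
  open import Data.Nat using (ℕ; zero; suc; _+_; _*_; _∸_; _≤_; _!; z≤n; s≤s)
  open import Data.Nat.Combinatorics.Base using (_P′_)
  open import Data.Nat.Combinatorics.Specification using (nP′n≡n!)
  open import Data.Nat.ListAction using (sum)
  open import Data.Nat.ListAction.Properties using (sum-++)
  open import Data.Nat.Properties hiding (_≟_)
  open import Data.Product using (_×_; _,_; proj₁)
  open import Data.Vec using (Vec; []; _∷_; lookup)
  open import Function using (_∘_; id)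
  open import Relation.Binary.PropositionalEquality
  open import Relation.Nullary.Decidable using (⌊_⌋; ⌊⌋-map′)

  open import Defs

  open CommSemigroupProperties +-commutativeSemigroup using ()
    renaming (interchange to +-interchange)
  open CommSemigroupProperties *-commutativeSemigroup using ()
    renaming (x∙yz≈z∙yx to x*yz≡z*yx)
  open CommSemigroupProperties (CommutativeMonoid.commutativeSemigroup ∧-commutativeMonoid) using ()
    renaming (interchange to ∧-interchange)

  private
    variable
      A B : Set
      k n : ℕ

  𝟙 : Bool → ℕ
  𝟙 true  = 1
  𝟙 false = 0

  𝟙-∧ : ∀ x y → 𝟙 (x ∧ y) ≡ 𝟙 x * 𝟙 y
  𝟙-∧ false y = refl
  𝟙-∧ true  y = sym (+-identityʳ (𝟙 y))

  ∧-true : ∀ {x y} → x ∧ y ≡ true → x ≡ true × y ≡ true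
  ∧-true {true}  y≡true = refl , y≡true
  ∧-true {false} ()

  ∑ : List A → (A → ℕ) → ℕ
  ∑ xs f = sum (map f xs)

  infix 5 ∑
  syntax ∑ xs (λ x → e) = ∑[ x ∈ xs ] e

  count≡∑𝟙 : (p : A → Bool) (xs : List A) → length (filterᵇ p xs) ≡ ∑[ x ∈ xs ] 𝟙 (p x)
  count≡∑𝟙 p []       = refl
  count≡∑𝟙 p (x ∷ xs) with p x
  ... | true  = cong suc (count≡∑𝟙 p xs)
  ... | false = count≡∑𝟙 p xs

  ∑-cong : (xs : List A) {f g : A → ℕ} → (∀ x → f x ≡ g x) → ∑ xs f ≡ ∑ xs g
  ∑-cong []       f≡g = refl
  ∑-cong (x ∷ xs) f≡g = cong₂ _+_ (f≡g x) (∑-cong xs f≡g)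

  ∑-mono : (xs : List A) {f g : A → ℕ} → (∀ x → f x ≤ g x) → ∑ xs f ≤ ∑ xs g
  ∑-mono []       f≤g = z≤n
  ∑-mono (x ∷ xs) f≤g = +-mono-≤ (f≤g x) (∑-mono xs f≤g)

  ∑-zero : (xs : List A) → ∑[ x ∈ xs ] 0 ≡ 0
  ∑-zero []       = refl
  ∑-zero (x ∷ xs) = ∑-zero xs

  ∑-+ : (xs : List A) (f g : A → ℕ) → ∑[ x ∈ xs ] (f x + g x) ≡ ∑ xs f + ∑ xs g
  ∑-+ []       f g = refl
  ∑-+ (x ∷ xs) f g = trans (cong (f x + g x +_) (∑-+ xs f g)) (+-interchange (f x) (g x) _ _)

  ∑-*ˡ : (xs : List A) (c : ℕ) (f : A → ℕ) → ∑[ x ∈ xs ] c * f x ≡ c * ∑ xs f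
  ∑-*ˡ []       c f = sym (*-zeroʳ c)
  ∑-*ˡ (x ∷ xs) c f = trans (cong (c * f x +_) (∑-*ˡ xs c f)) (sym (*-distribˡ-+ c (f x) _))

  ∑-*ʳ : (xs : List A) (c : ℕ) (f : A → ℕ) → ∑[ x ∈ xs ] f x * c ≡ ∑ xs f * c
  ∑-*ʳ xs c f = trans (∑-cong xs (λ x → *-comm (f x) c)) (trans (∑-*ˡ xs c f) (*-comm c _))

  ∑-comm : (xs : List A) (ys : List B) (f : A → B → ℕ) →
           ∑[ x ∈ xs ] ∑[ y ∈ ys ] f x y ≡ ∑[ y ∈ ys ] ∑[ x ∈ xs ] f x y
  ∑-comm []       ys f = sym (∑-zero ys)
  ∑-comm (x ∷ xs) ys f =
    trans (cong (∑ ys (f x) +_) (∑-comm xs ys f)) (sym (∑-+ ys (f x) (λ y → ∑[ x ∈ xs ] f x y)))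

  ∑-++ : (xs ys : List A) (f : A → ℕ) → ∑ (xs ++ ys) f ≡ ∑ xs f + ∑ ys f
  ∑-++ xs ys f = trans (cong sum (map-++ f xs ys)) (sum-++ (map f xs) (map f ys))

  ∑-concatMap : (g : A → List B) (xs : List A) (f : B → ℕ) →
                ∑ (concatMap g xs) f ≡ ∑[ x ∈ xs ] ∑ (g x) f
  ∑-concatMap g []       f = refl
  ∑-concatMap g (x ∷ xs) f = trans (∑-++ (g x) (concatMap g xs) f) (cong (∑ (g x) f +_) (∑-concatMap g xs f))

  ∑-map : (h : A → B) (xs : List A) (f : B → ℕ) → ∑ (map h xs) f ≡ ∑ xs (f ∘ h)
  ∑-map h xs f = cong sum (sym (map-∘ xs))

  ∑-𝟙*-const : (xs : List A) (c : A → Bool) (w : A → ℕ) {K : ℕ} → (∀ x → c x ≡ true → w x ≡ K) →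
               ∑[ x ∈ xs ] 𝟙 (c x) * w x ≡ (∑[ x ∈ xs ] 𝟙 (c x)) * K
  ∑-𝟙*-const xs c w {K} w≡K = trans (∑-cong xs 𝟙*w≡𝟙*K) (∑-*ʳ xs K (𝟙 ∘ c))
    where
    𝟙*w≡𝟙*K : ∀ x → 𝟙 (c x) * w x ≡ 𝟙 (c x) * K
    𝟙*w≡𝟙*K x with c x in cx
    ... | true  = cong (_+ 0) (w≡K x cx)
    ... | false = refl

  ∑-allFin-suc : (f : Fin (suc k) → ℕ) → ∑ (allFin (suc k)) f ≡ f zero + (∑[ b ∈ allFin k ] f (suc b))
  ∑-allFin-suc f = cong (f zero +_) (trans (cong sum (map-tabulate suc f)) (sym (cong sum (map-tabulate id (f ∘ suc)))))

  ∑-allVecs-suc : (f : Vec (Fin k) (suc n) → ℕ) →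
                  ∑ (allVecs (suc n) k) f ≡ ∑[ v ∈ allVecs n k ] ∑[ b ∈ allFin k ] f (b ∷ v)
  ∑-allVecs-suc {k} {n} f =
    trans (∑-concatMap _ (allVecs n k) f) (∑-cong (allVecs n k) (λ v → ∑-map (_∷ v) (allFin k) f))

  ≟-sym : (b c : Fin k) → ⌊ b ≟ c ⌋ ≡ ⌊ c ≟ b ⌋
  ≟-sym zero    zero    = refl
  ≟-sym zero    (suc c) = refl
  ≟-sym (suc b) zero    = refl
  ≟-sym (suc b) (suc c) =
    trans (⌊⌋-map′ _ _ (b ≟ c)) (trans (≟-sym b c) (sym (⌊⌋-map′ _ _ (c ≟ b))))

  ∑-select : (c : Fin k) (f : Fin k → ℕ) → (∑[ b ∈ allFin k ] 𝟙 ⌊ b ≟ c ⌋ * f b) ≡ f c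
  ∑-select {suc k} zero f =
    trans (∑-allFin-suc (λ b → 𝟙 ⌊ b ≟ zero ⌋ * f b))
          (trans (cong₂ _+_ (+-identityʳ (f zero)) (∑-zero (allFin k))) (+-identityʳ (f zero)))
  ∑-select {suc k} (suc c) f =
    trans (∑-allFin-suc (λ b → 𝟙 ⌊ b ≟ suc c ⌋ * f b))
          (trans (∑-cong (allFin k) (λ b → cong (λ t → 𝟙 t * f (suc b)) (⌊⌋-map′ _ _ (b ≟ c))))
                 (∑-select c (f ∘ suc)))

  allᵇ : (Fin k → Bool) → Vec (Fin k) n → Bool
  allᵇ p []      = true
  allᵇ p (a ∷ v) = p a ∧ allᵇ p v

  allᵇ-true : (v : Vec (Fin k) n) → allᵇ (λ _ → true) v ≡ true
  allᵇ-true []      = refl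
  allᵇ-true (a ∷ v) = allᵇ-true v

  allᵇ-∧ : (p q : Fin k → Bool) (v : Vec (Fin k) n) → allᵇ (λ b → p b ∧ q b) v ≡ allᵇ p v ∧ allᵇ q v
  allᵇ-∧ p q []      = refl
  allᵇ-∧ p q (a ∷ v) = trans (cong ((p a ∧ q a) ∧_) (allᵇ-∧ p q v)) (∧-interchange (p a) (q a) _ _)

  allᵇ-≢ : (c : Fin k) (v : Vec (Fin k) n) → allᵇ (λ b → not ⌊ b ≟ c ⌋) v ≡ not (elemᵇ c v)
  allᵇ-≢ c []      = refl
  allᵇ-≢ c (b ∷ v) =
    trans (cong₂ _∧_ (cong not (≟-sym b c)) (allᵇ-≢ c v)) (sym (deMorgan₂ ⌊ c ≟ b ⌋ (elemᵇ c v)))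

  ∑-1 : (k : ℕ) → (∑[ b ∈ allFin k ] 1) ≡ k
  ∑-1 zero    = refl
  ∑-1 (suc k) = trans (∑-allFin-suc {k} (λ _ → 1)) (cong suc (∑-1 k))

  ∑-𝟙-remove : (q : Fin k → Bool) (c : Fin k) → q c ≡ true →
               (∑[ b ∈ allFin k ] 𝟙 (q b)) ≡ (∑[ b ∈ allFin k ] 𝟙 (q b ∧ not ⌊ b ≟ c ⌋)) + 1
  ∑-𝟙-remove {k} q c qc = begin
      ∑[ b ∈ allFin k ] 𝟙 (q b)
    ≡⟨ ∑-cong (allFin k) (λ b → 𝟙-split (q b) ⌊ b ≟ c ⌋) ⟩
      ∑[ b ∈ allFin k ] (𝟙 (q b ∧ not ⌊ b ≟ c ⌋) + 𝟙 ⌊ b ≟ c ⌋ * 𝟙 (q b))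
    ≡⟨ ∑-+ (allFin k) _ _ ⟩
      (∑[ b ∈ allFin k ] 𝟙 (q b ∧ not ⌊ b ≟ c ⌋)) + (∑[ b ∈ allFin k ] 𝟙 ⌊ b ≟ c ⌋ * 𝟙 (q b))
    ≡⟨ cong ((∑[ b ∈ allFin k ] 𝟙 (q b ∧ not ⌊ b ≟ c ⌋)) +_) (trans (∑-select c (𝟙 ∘ q)) (cong 𝟙 qc)) ⟩
      (∑[ b ∈ allFin k ] 𝟙 (q b ∧ not ⌊ b ≟ c ⌋)) + 1
    ∎
    where
    open ≡-Reasoning
    𝟙-split : ∀ x y → 𝟙 x ≡ 𝟙 (x ∧ not y) + 𝟙 y * 𝟙 x
    𝟙-split false false = refl
    𝟙-split false true  = refl
    𝟙-split true  false = refl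
    𝟙-split true  true  = refl

  ∑-𝟙-fresh : (p : Fin k → Bool) (v : Vec (Fin k) n) → distinctᵇ v ≡ true → allᵇ p v ≡ true →
              (∑[ b ∈ allFin k ] 𝟙 (p b ∧ not (elemᵇ b v))) ≡ (∑[ b ∈ allFin k ] 𝟙 (p b)) ∸ n
  ∑-𝟙-fresh {k} {n} p v dist all = trans (sym (m+n∸n≡m _ n)) (cong (_∸ n) (fresh+n p v dist all))
    where
    open ≡-Reasoning
    fresh+n : ∀ {n} (p : Fin k → Bool) (v : Vec (Fin k) n) → distinctᵇ v ≡ true → allᵇ p v ≡ true →
              (∑[ b ∈ allFin k ] 𝟙 (p b ∧ not (elemᵇ b v))) + n ≡ ∑[ b ∈ allFin k ] 𝟙 (p b)
    fresh+n p [] _ _ = trans (+-identityʳ _) (∑-cong (allFin k) (λ b → cong 𝟙 (∧-identityʳ (p b))))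
    fresh+n {suc n} p (c ∷ w) dist all with ∧-true dist | ∧-true all
    ... | c∉w , dist-w | pc , all-w = begin
        (∑[ b ∈ allFin k ] 𝟙 (p b ∧ not (⌊ b ≟ c ⌋ ∨ elemᵇ b w))) + suc n
      ≡⟨ cong (_+ suc n) (∑-cong (allFin k) (λ b → cong 𝟙 (∧-not-∨ (p b) ⌊ b ≟ c ⌋ (elemᵇ b w)))) ⟩
        (∑[ b ∈ allFin k ] 𝟙 (p′ b ∧ not (elemᵇ b w))) + suc n
      ≡⟨ +-suc _ n ⟩
        suc ((∑[ b ∈ allFin k ] 𝟙 (p′ b ∧ not (elemᵇ b w))) + n)
      ≡⟨ cong suc (fresh+n p′ w dist-w all-p′-w) ⟩
        suc (∑[ b ∈ allFin k ] 𝟙 (p′ b))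
      ≡⟨ +-comm 1 _ ⟩
        (∑[ b ∈ allFin k ] 𝟙 (p′ b)) + 1
      ≡⟨ ∑-𝟙-remove p c pc ⟨
        ∑[ b ∈ allFin k ] 𝟙 (p b)
      ∎
      where
      p′ : Fin k → Bool
      p′ b = p b ∧ not ⌊ b ≟ c ⌋
      ∧-not-∨ : ∀ x y z → x ∧ not (y ∨ z) ≡ (x ∧ not y) ∧ not z
      ∧-not-∨ x y z = trans (cong (x ∧_) (deMorgan₂ y z)) (sym (∧-assoc x (not y) (not z)))
      all-p′-w : allᵇ p′ w ≡ true
      all-p′-w = trans (allᵇ-∧ p _ w) (cong₂ _∧_ all-w (trans (allᵇ-≢ c w) c∉w))

  fresh-values : (v : Vec (Fin k) n) → distinctᵇ v ≡ true →
                 (∑[ b ∈ allFin k ] 𝟙 (not (elemᵇ b v))) ≡ k ∸ n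
  fresh-values {k} {n} v dist = trans (∑-𝟙-fresh (λ _ → true) v dist (allᵇ-true v)) (cong (_∸ n) (∑-1 k))

  injections-into : (p : Fin k → Bool) (n : ℕ) →
                    (∑[ v ∈ allVecs n k ] 𝟙 (distinctᵇ v ∧ allᵇ p v)) ≡ (∑[ b ∈ allFin k ] 𝟙 (p b)) P′ n
  injections-into p zero = refl
  injections-into {k} p (suc n) = begin
      ∑[ v ∈ allVecs (suc n) k ] 𝟙 (distinctᵇ v ∧ allᵇ p v)
    ≡⟨ ∑-allVecs-suc {k} {n} (λ v → 𝟙 (distinctᵇ v ∧ allᵇ p v)) ⟩
      ∑[ v ∈ allVecs n k ] ∑[ b ∈ allFin k ] 𝟙 ((not (elemᵇ b v) ∧ distinctᵇ v) ∧ (p b ∧ allᵇ p v))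
    ≡⟨ ∑-cong (allVecs n k) (λ v →
         trans (∑-cong (allFin k) (λ b → 𝟙-factor (not (elemᵇ b v)) (distinctᵇ v) (p b) (allᵇ p v)))
               (∑-*ˡ (allFin k) (𝟙 (distinctᵇ v ∧ allᵇ p v)) _)) ⟩
      ∑[ v ∈ allVecs n k ] 𝟙 (distinctᵇ v ∧ allᵇ p v) * (∑[ b ∈ allFin k ] 𝟙 (p b ∧ not (elemᵇ b v)))
    ≡⟨ ∑-𝟙*-const (allVecs n k) _ _ fresh ⟩
      (∑[ v ∈ allVecs n k ] 𝟙 (distinctᵇ v ∧ allᵇ p v)) * (size ∸ n)
    ≡⟨ cong (_* (size ∸ n)) (injections-into p n) ⟩
      (size P′ n) * (size ∸ n)
    ≡⟨ *-comm (size P′ n) (size ∸ n) ⟩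
      size P′ suc n
    ∎
    where
    open ≡-Reasoning
    size : ℕ
    size = ∑[ b ∈ allFin k ] 𝟙 (p b)
    𝟙-factor : ∀ x y z w → 𝟙 ((x ∧ y) ∧ (z ∧ w)) ≡ 𝟙 (y ∧ w) * 𝟙 (z ∧ x)
    𝟙-factor x y z w = trans (cong 𝟙 (trans (∧-interchange x y z w)
                                      (trans (∧-comm (x ∧ z) (y ∧ w)) (cong ((y ∧ w) ∧_) (∧-comm x z)))))
                             (𝟙-∧ (y ∧ w) (z ∧ x))
    fresh : ∀ v → distinctᵇ v ∧ allᵇ p v ≡ true →
            (∑[ b ∈ allFin k ] 𝟙 (p b ∧ not (elemᵇ b v))) ≡ size ∸ n
    fresh v dist∧all with ∧-true dist∧all
    ... | dist , all = ∑-𝟙-fresh p v dist all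

  injections : (k n : ℕ) → (∑[ v ∈ allVecs n k ] 𝟙 (distinctᵇ v)) ≡ k P′ n
  injections k n = begin
      ∑[ v ∈ allVecs n k ] 𝟙 (distinctᵇ v)
    ≡⟨ ∑-cong (allVecs n k) (λ v → cong 𝟙 (sym (trans (cong (distinctᵇ v ∧_) (allᵇ-true v)) (∧-identityʳ _)))) ⟩
      ∑[ v ∈ allVecs n k ] 𝟙 (distinctᵇ v ∧ allᵇ (λ _ → true) v)
    ≡⟨ injections-into (λ _ → true) n ⟩
      (∑[ b ∈ allFin k ] 1) P′ n
    ≡⟨ cong (_P′ n) (∑-1 k) ⟩
      k P′ n
    ∎
    where open ≡-Reasoning

  injections-avoiding : (a : Fin (suc k)) (n : ℕ) →
                        (∑[ v ∈ allVecs n (suc k) ] 𝟙 (not (elemᵇ a v) ∧ distinctᵇ v)) ≡ k P′ n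
  injections-avoiding {k} a n = begin
      ∑[ v ∈ allVecs n (suc k) ] 𝟙 (not (elemᵇ a v) ∧ distinctᵇ v)
    ≡⟨ ∑-cong (allVecs n (suc k)) (λ v → cong 𝟙 (∉⇒all≢ v)) ⟩
      ∑[ v ∈ allVecs n (suc k) ] 𝟙 (distinctᵇ v ∧ allᵇ (λ b → not ⌊ b ≟ a ⌋) v)
    ≡⟨ injections-into (λ b → not ⌊ b ≟ a ⌋) n ⟩
      (∑[ b ∈ allFin (suc k) ] 𝟙 (not ⌊ b ≟ a ⌋)) P′ n
    ≡⟨ cong (_P′ n) size-≢ ⟩
      k P′ n
    ∎
    where
    open ≡-Reasoning
    ∉⇒all≢ : ∀ v → not (elemᵇ a v) ∧ distinctᵇ v ≡ distinctᵇ v ∧ allᵇ (λ b → not ⌊ b ≟ a ⌋) v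
    ∉⇒all≢ v = trans (∧-comm (not (elemᵇ a v)) (distinctᵇ v)) (cong (distinctᵇ v ∧_) (sym (allᵇ-≢ a v)))
    size-≢ : (∑[ b ∈ allFin (suc k) ] 𝟙 (not ⌊ b ≟ a ⌋)) ≡ k
    size-≢ = suc-injective (begin
        suc (∑[ b ∈ allFin (suc k) ] 𝟙 (not ⌊ b ≟ a ⌋))   ≡⟨ +-comm 1 _ ⟩
        (∑[ b ∈ allFin (suc k) ] 𝟙 (not ⌊ b ≟ a ⌋)) + 1   ≡⟨ ∑-𝟙-remove (λ _ → true) a refl ⟨
        ∑[ b ∈ allFin (suc k) ] 1                         ≡⟨ ∑-1 (suc k) ⟩
        suc k                                             ∎)

  injections-through : (i : Fin (suc n)) (a : Fin (suc k)) →
                       (∑[ v ∈ allVecs (suc n) (suc k) ] 𝟙 (distinctᵇ v ∧ ⌊ lookup v i ≟ a ⌋)) ≡ k P′ n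
  injections-through {n} {k} zero a = begin
      ∑[ v ∈ allVecs (suc n) (suc k) ] 𝟙 (distinctᵇ v ∧ ⌊ lookup v zero ≟ a ⌋)
    ≡⟨ ∑-allVecs-suc {suc k} {n} (λ v → 𝟙 (distinctᵇ v ∧ ⌊ lookup v zero ≟ a ⌋)) ⟩
      ∑[ v ∈ allVecs n (suc k) ] ∑[ b ∈ allFin (suc k) ] 𝟙 ((not (elemᵇ b v) ∧ distinctᵇ v) ∧ ⌊ b ≟ a ⌋)
    ≡⟨ ∑-cong (allVecs n (suc k)) (λ v →
         trans (∑-cong (allFin (suc k)) (λ b → 𝟙-swap (not (elemᵇ b v) ∧ distinctᵇ v) ⌊ b ≟ a ⌋))
               (∑-select a (λ b → 𝟙 (not (elemᵇ b v) ∧ distinctᵇ v)))) ⟩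
      ∑[ v ∈ allVecs n (suc k) ] 𝟙 (not (elemᵇ a v) ∧ distinctᵇ v)
    ≡⟨ injections-avoiding a n ⟩
      k P′ n
    ∎
    where
    open ≡-Reasoning
    𝟙-swap : ∀ x y → 𝟙 (x ∧ y) ≡ 𝟙 y * 𝟙 x
    𝟙-swap x y = trans (𝟙-∧ x y) (*-comm (𝟙 x) (𝟙 y))
  injections-through {suc n} {k} (suc i) a = begin
      ∑[ v ∈ allVecs (suc (suc n)) (suc k) ] 𝟙 (distinctᵇ v ∧ ⌊ lookup v (suc i) ≟ a ⌋)
    ≡⟨ ∑-allVecs-suc {suc k} {suc n} (λ v → 𝟙 (distinctᵇ v ∧ ⌊ lookup v (suc i) ≟ a ⌋)) ⟩
      ∑[ v ∈ allVecs (suc n) (suc k) ] ∑[ b ∈ allFin (suc k) ]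
        𝟙 ((not (elemᵇ b v) ∧ distinctᵇ v) ∧ ⌊ lookup v i ≟ a ⌋)
    ≡⟨ ∑-cong (allVecs (suc n) (suc k)) (λ v →
         trans (∑-cong (allFin (suc k)) (λ b → 𝟙-rotate (not (elemᵇ b v)) (distinctᵇ v) ⌊ lookup v i ≟ a ⌋))
               (∑-*ˡ (allFin (suc k)) (𝟙 (distinctᵇ v ∧ ⌊ lookup v i ≟ a ⌋)) _)) ⟩
      ∑[ v ∈ allVecs (suc n) (suc k) ]
        𝟙 (distinctᵇ v ∧ ⌊ lookup v i ≟ a ⌋) * (∑[ b ∈ allFin (suc k) ] 𝟙 (not (elemᵇ b v)))
    ≡⟨ ∑-𝟙*-const (allVecs (suc n) (suc k)) _ _ (λ v dist∧eq → fresh-values v (proj₁ (∧-true dist∧eq))) ⟩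
      (∑[ v ∈ allVecs (suc n) (suc k) ] 𝟙 (distinctᵇ v ∧ ⌊ lookup v i ≟ a ⌋)) * (k ∸ n)
    ≡⟨ cong (_* (k ∸ n)) (injections-through i a) ⟩
      (k P′ n) * (k ∸ n)
    ≡⟨ *-comm (k P′ n) (k ∸ n) ⟩
      k P′ suc n
    ∎
    where
    open ≡-Reasoning
    𝟙-rotate : ∀ x y z → 𝟙 ((x ∧ y) ∧ z) ≡ 𝟙 (y ∧ z) * 𝟙 x
    𝟙-rotate x y z = trans (cong 𝟙 (trans (∧-assoc x y z) (∧-comm x (y ∧ z)))) (𝟙-∧ (y ∧ z) x)

  hits : (Fin n → Fin k → Bool) → Vec (Fin k) n → ℕ
  hits {n} H v = ∑[ i ∈ allFin n ] 𝟙 (H i (lookup v i))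

  avoids-or-hits : (H : Fin n → Fin k → Bool) (v : Vec (Fin k) n) → 1 ≤ 𝟙 (avoidsᵇ H v) + hits H v
  avoids-or-hits H []      = s≤s z≤n
  avoids-or-hits {suc n} H (a ∷ v) rewrite ∑-allFin-suc {n} (λ i → 𝟙 (H i (lookup (a ∷ v) i))) with H zero a
  ... | true  = s≤s z≤n
  ... | false = avoids-or-hits (λ i → H (suc i)) v

  𝟙*-as-∑ : (x : Bool) (c : Fin k) (f : Fin k → ℕ) →
            𝟙 x * f c ≡ ∑[ a ∈ allFin k ] f a * 𝟙 (x ∧ ⌊ c ≟ a ⌋)
  𝟙*-as-∑ {k} x c f = sym (trans (∑-cong (allFin k) select-c) (∑-select c (λ a → 𝟙 x * f a)))
    where
    select-c : ∀ a → f a * 𝟙 (x ∧ ⌊ c ≟ a ⌋) ≡ 𝟙 ⌊ a ≟ c ⌋ * (𝟙 x * f a)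
    select-c a = trans (cong (f a *_) (trans (𝟙-∧ x ⌊ c ≟ a ⌋) (cong (λ t → 𝟙 x * 𝟙 t) (≟-sym c a))))
                       (x*yz≡z*yx (f a) (𝟙 x) _)

  ∑-injections-hits : (H : Fin (suc n) → Fin (suc k) → Bool) →
    (∑[ v ∈ allVecs (suc n) (suc k) ] 𝟙 (distinctᵇ v) * hits H v)
      ≡ (∑[ i ∈ allFin (suc n) ] ∑[ a ∈ allFin (suc k) ] 𝟙 (H i a)) * (k P′ n)
  ∑-injections-hits {n} {k} H = begin
      ∑[ v ∈ Vs ] 𝟙 (distinctᵇ v) * hits H v
    ≡⟨ ∑-cong Vs (λ v → trans (sym (∑-*ˡ Is (𝟙 (distinctᵇ v)) _))
                              (∑-cong Is (λ i → 𝟙*-as-∑ (distinctᵇ v) (lookup v i) (𝟙 ∘ H i)))) ⟩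
      ∑[ v ∈ Vs ] ∑[ i ∈ Is ] ∑[ a ∈ As ] 𝟙 (H i a) * 𝟙 (distinctᵇ v ∧ ⌊ lookup v i ≟ a ⌋)
    ≡⟨ ∑-comm Vs Is _ ⟩
      ∑[ i ∈ Is ] ∑[ v ∈ Vs ] ∑[ a ∈ As ] 𝟙 (H i a) * 𝟙 (distinctᵇ v ∧ ⌊ lookup v i ≟ a ⌋)
    ≡⟨ ∑-cong Is (λ i → ∑-comm Vs As _) ⟩
      ∑[ i ∈ Is ] ∑[ a ∈ As ] ∑[ v ∈ Vs ] 𝟙 (H i a) * 𝟙 (distinctᵇ v ∧ ⌊ lookup v i ≟ a ⌋)
    ≡⟨ ∑-cong Is (λ i → ∑-cong As (λ a →
         trans (∑-*ˡ Vs (𝟙 (H i a)) _) (cong (𝟙 (H i a) *_) (injections-through i a)))) ⟩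
      ∑[ i ∈ Is ] ∑[ a ∈ As ] 𝟙 (H i a) * (k P′ n)
    ≡⟨ trans (∑-cong Is (λ i → ∑-*ʳ As (k P′ n) (𝟙 ∘ H i)))
             (∑-*ʳ Is (k P′ n) (λ i → ∑[ a ∈ As ] 𝟙 (H i a))) ⟩
      (∑[ i ∈ Is ] ∑[ a ∈ As ] 𝟙 (H i a)) * (k P′ n)
    ∎
    where
    open ≡-Reasoning
    Vs : List (Vec (Fin (suc k)) (suc n))
    Vs = allVecs (suc n) (suc k)
    Is : List (Fin (suc n))
    Is = allFin (suc n)
    As : List (Fin (suc k))
    As = allFin (suc k)

  injections-union-bound : (H : Fin (suc n) → Fin (suc k) → Bool) →
    suc k P′ suc n ≤ (∑[ v ∈ allVecs (suc n) (suc k) ] 𝟙 (distinctᵇ v ∧ avoidsᵇ H v))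
                     + (∑[ i ∈ allFin (suc n) ] ∑[ a ∈ allFin (suc k) ] 𝟙 (H i a)) * (k P′ n)
  injections-union-bound {n} {k} H = begin
      suc k P′ suc n
    ≡⟨ injections (suc k) (suc n) ⟨
      ∑[ v ∈ Vs ] 𝟙 (distinctᵇ v)
    ≤⟨ ∑-mono Vs distinct-avoids-or-hits ⟩
      ∑[ v ∈ Vs ] (𝟙 (distinctᵇ v ∧ avoidsᵇ H v) + 𝟙 (distinctᵇ v) * hits H v)
    ≡⟨ ∑-+ Vs _ _ ⟩
      (∑[ v ∈ Vs ] 𝟙 (distinctᵇ v ∧ avoidsᵇ H v)) + (∑[ v ∈ Vs ] 𝟙 (distinctᵇ v) * hits H v)
    ≡⟨ cong ((∑[ v ∈ Vs ] 𝟙 (distinctᵇ v ∧ avoidsᵇ H v)) +_) (∑-injections-hits H) ⟩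
      (∑[ v ∈ Vs ] 𝟙 (distinctᵇ v ∧ avoidsᵇ H v))
        + (∑[ i ∈ allFin (suc n) ] ∑[ a ∈ allFin (suc k) ] 𝟙 (H i a)) * (k P′ n)
    ∎
    where
    open ≤-Reasoning
    Vs : List (Vec (Fin (suc k)) (suc n))
    Vs = allVecs (suc n) (suc k)
    distinct-avoids-or-hits : ∀ v →
      𝟙 (distinctᵇ v) ≤ 𝟙 (distinctᵇ v ∧ avoidsᵇ H v) + 𝟙 (distinctᵇ v) * hits H v
    distinct-avoids-or-hits v = begin
        𝟙 (distinctᵇ v)
      ≡⟨ *-identityʳ _ ⟨
        𝟙 (distinctᵇ v) * 1
      ≤⟨ *-monoʳ-≤ (𝟙 (distinctᵇ v)) (avoids-or-hits H v) ⟩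
        𝟙 (distinctᵇ v) * (𝟙 (avoidsᵇ H v) + hits H v)
      ≡⟨ *-distribˡ-+ (𝟙 (distinctᵇ v)) _ _ ⟩
        𝟙 (distinctᵇ v) * 𝟙 (avoidsᵇ H v) + 𝟙 (distinctᵇ v) * hits H v
      ≡⟨ cong (_+ 𝟙 (distinctᵇ v) * hits H v) (𝟙-∧ (distinctᵇ v) (avoidsᵇ H v)) ⟨
        𝟙 (distinctᵇ v ∧ avoidsᵇ H v) + 𝟙 (distinctᵇ v) * hits H v
      ∎

  perfectMatchings-union-bound : (H : BipGraph (suc k)) → suc k ! ≤ numPerfectMatchings H + numEdges H * k !
  perfectMatchings-union-bound {k} H =
    subst₂ _≤_ (nP′n≡n! (suc k))
               (cong₂ _+_ (sym (count≡∑𝟙 _ (allVecs (suc k) (suc k)))) (cong₂ _*_ edges (nP′n≡n! k)))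
               (injections-union-bound H)
    where
    edges : (∑[ i ∈ allFin (suc k) ] ∑[ a ∈ allFin (suc k) ] 𝟙 (H i a)) ≡ numEdges H
    edges = ∑-cong (allFin (suc k)) (λ i → sym (count≡∑𝟙 (H i) (allFin (suc k))))


module RationalBound where

  open import Data.Integer as ℤ using (+_)
  import Data.Integer.Properties as ℤ
  open import Data.Nat as ℕ using (ℕ; suc; _!)
  open import Data.Rational using (ℚ; _/_; _+_; _-_; _*_; -_; _≤_; _<_; 0ℚ; 1ℚ; toℚᵘ; nonNegative; *<*)
  open import Data.Rational.Properties
  open import Data.Rational.Solver using (module +-*-Solver)
  open import Data.Rational.Unnormalised as ℚᵘ using (ℚᵘ; mkℚᵘ; *≡*; *≤*)
  import Data.Rational.Unnormalised.Properties as ℚᵘ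
  open import Relation.Binary.PropositionalEquality

  open import Defs
  open Injections using (perfectMatchings-union-bound)

  ↑ : ℕ → ℚᵘ
  ↑ n = mkℚᵘ (+ n) 0

  ↑-+ : ∀ a b → ↑ (a ℕ.+ b) ℚᵘ.≃ ↑ a ℚᵘ.+ ↑ b
  ↑-+ a b = *≡* (begin
      + (a ℕ.+ b) ℤ.* + 1               ≡⟨ ℤ.*-identityʳ _ ⟩
      + (a ℕ.+ b)                       ≡⟨ ℤ.pos-+ a b ⟩
      + a ℤ.+ + b                       ≡⟨ cong₂ ℤ._+_ (ℤ.*-identityʳ (+ a)) (ℤ.*-identityʳ (+ b)) ⟨
      + a ℤ.* + 1 ℤ.+ + b ℤ.* + 1       ≡⟨ ℤ.*-identityʳ _ ⟨
      (+ a ℤ.* + 1 ℤ.+ + b ℤ.* + 1) ℤ.* + 1 ∎)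
    where open ≡-Reasoning

  ↑-* : ∀ a b → ↑ (a ℕ.* b) ℚᵘ.≃ ↑ a ℚᵘ.* ↑ b
  ↑-* a b = *≡* (trans (ℤ.*-identityʳ _) (trans (ℤ.pos-* a b) (sym (ℤ.*-identityʳ _))))

  toℚᵘ-toℚ : ∀ n → toℚᵘ (toℚ n) ℚᵘ.≃ ↑ n
  toℚᵘ-toℚ n = toℚᵘ-fromℚᵘ (↑ n)

  toℚ-+ : ∀ a b → toℚ (a ℕ.+ b) ≡ toℚ a + toℚ b
  toℚ-+ a b = toℚᵘ-injective (begin
      toℚᵘ (toℚ (a ℕ.+ b))            ≈⟨ toℚᵘ-toℚ (a ℕ.+ b) ⟩
      ↑ (a ℕ.+ b)                     ≈⟨ ↑-+ a b ⟩
      ↑ a ℚᵘ.+ ↑ b                    ≈⟨ ℚᵘ.+-cong (toℚᵘ-toℚ a) (toℚᵘ-toℚ b) ⟨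
      toℚᵘ (toℚ a) ℚᵘ.+ toℚᵘ (toℚ b)  ≈⟨ toℚᵘ-homo-+ (toℚ a) (toℚ b) ⟨
      toℚᵘ (toℚ a + toℚ b)            ∎)
    where open ℚᵘ.≃-Reasoning

  toℚ-* : ∀ a b → toℚ (a ℕ.* b) ≡ toℚ a * toℚ b
  toℚ-* a b = toℚᵘ-injective (begin
      toℚᵘ (toℚ (a ℕ.* b))            ≈⟨ toℚᵘ-toℚ (a ℕ.* b) ⟩
      ↑ (a ℕ.* b)                     ≈⟨ ↑-* a b ⟩
      ↑ a ℚᵘ.* ↑ b                    ≈⟨ ℚᵘ.*-cong (toℚᵘ-toℚ a) (toℚᵘ-toℚ b) ⟨
      toℚᵘ (toℚ a) ℚᵘ.* toℚᵘ (toℚ b)  ≈⟨ toℚᵘ-homo-* (toℚ a) (toℚ b) ⟨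
      toℚᵘ (toℚ a * toℚ b)            ∎)
    where open ℚᵘ.≃-Reasoning

  toℚ-mono-≤ : ∀ {a b} → a ℕ.≤ b → toℚ a ≤ toℚ b
  toℚ-mono-≤ {a} {b} a≤b = toℚᵘ-cancel-≤ (begin
      toℚᵘ (toℚ a)  ≃⟨ toℚᵘ-toℚ a ⟩
      ↑ a           ≤⟨ *≤* (ℤ.*-monoʳ-≤-nonNeg (+ 1) (ℤ.+≤+ a≤b)) ⟩
      ↑ b           ≃⟨ toℚᵘ-toℚ b ⟨
      toℚᵘ (toℚ b)  ∎)
    where open ℚᵘ.≤-Reasoning

  /-*-cancel : ∀ e k → (+ e / suc k) * toℚ (suc k) ≡ toℚ e
  /-*-cancel e k = toℚᵘ-injective (begin
      toℚᵘ ((+ e / suc k) * toℚ (suc k))              ≈⟨ toℚᵘ-homo-* (+ e / suc k) (toℚ (suc k)) ⟩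
      toℚᵘ (+ e / suc k) ℚᵘ.* toℚᵘ (toℚ (suc k))      ≈⟨ ℚᵘ.*-cong (toℚᵘ-fromℚᵘ (mkℚᵘ (+ e) k)) (toℚᵘ-toℚ (suc k)) ⟩
      mkℚᵘ (+ e) k ℚᵘ.* ↑ (suc k)                     ≈⟨ *≡* (trans (ℤ.*-assoc (+ e) (+ suc k) (+ 1))
                                                                      (cong (+ e ℤ.*_) (sym (ℤ.pos-* (suc k) 1)))) ⟩
      ↑ e                                             ≈⟨ toℚᵘ-toℚ e ⟨
      toℚᵘ (toℚ e)                                    ∎)
    where open ℚᵘ.≃-Reasoning

  1-x²-bound : ∀ {x F P ε} → 0ℚ ≤ x → 0ℚ < ε → (1ℚ - x) * F ≤ P → (1ℚ - x * x) * F - ε ≤ P * (1ℚ + x)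
  1-x²-bound {x} {F} {P} {ε} x≥0 ε>0 [1-x]F≤P = begin
      (1ℚ - x * x) * F - ε
    ≤⟨ +-monoʳ-≤ ((1ℚ - x * x) * F) (neg-antimono-≤ (<⇒≤ ε>0)) ⟩
      (1ℚ - x * x) * F - 0ℚ
    ≡⟨ solve 2 (λ x F → (con 1ℚ :- x :* x) :* F :- con 0ℚ := (con 1ℚ :- x) :* F :* (con 1ℚ :+ x)) refl x F ⟩
      (1ℚ - x) * F * (1ℚ + x)
    ≤⟨ *-monoʳ-≤-nonNeg (1ℚ + x) {{nonNegative 1+x≥0}} [1-x]F≤P ⟩
      P * (1ℚ + x)
    ∎
    where
    open ≤-Reasoning
    open +-*-Solver
    1+x≥0 : 0ℚ ≤ 1ℚ + x
    1+x≥0 = +-mono-≤ {0ℚ} {1ℚ} (<⇒≤ (*<* (ℤ.+<+ (ℕ.s≤s ℕ.z≤n)))) x≥0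

  expPartial-1 : ∀ x → expPartial 1 x ≡ 1ℚ + x
  expPartial-1 x = cong (_+_ 1ℚ) (trans (*-identityʳ (x * 1ℚ)) (*-identityʳ x))

  module _ (k : ℕ) (H : BipGraph (suc k)) where

    private
      x : ℚ
      x = + numEdges H / suc k

    perfectMatchings-ℚ-bound : (1ℚ - x) * toℚ (suc k !) ≤ toℚ (numPerfectMatchings H)
    perfectMatchings-ℚ-bound = subst₂ _≤_
      (solve 2 (λ F y → F :+ :- (y :* F) := (con 1ℚ :- y) :* F) refl F x)
      (solve 3 (λ P y F → P :+ y :* F :+ :- (y :* F) := P) refl P x F)
      (+-monoˡ-≤ (- (x * F)) F≤P+xF)
      where
      open +-*-Solver
      F P : ℚ
      F = toℚ (suc k !)
      P = toℚ (numPerfectMatchings H)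
      F≤P+xF : F ≤ P + x * F
      F≤P+xF = ≤-trans (toℚ-mono-≤ (perfectMatchings-union-bound H)) (≤-reflexive (begin
          toℚ (numPerfectMatchings H ℕ.+ numEdges H ℕ.* k !)  ≡⟨ toℚ-+ (numPerfectMatchings H) (numEdges H ℕ.* k !) ⟩
          P + toℚ (numEdges H ℕ.* k !)                      ≡⟨ cong (_+_ P) (toℚ-* (numEdges H) (k !)) ⟩
          P + toℚ (numEdges H) * toℚ (k !)                  ≡⟨ cong (λ e → P + e * toℚ (k !)) (/-*-cancel (numEdges H) k) ⟨
          P + x * toℚ (suc k) * toℚ (k !)                   ≡⟨ cong (_+_ P) (*-assoc x (toℚ (suc k)) (toℚ (k !))) ⟩
          P + x * (toℚ (suc k) * toℚ (k !))                 ≡⟨ cong (λ y → P + x * y) (toℚ-* (suc k) (k !)) ⟨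
          P + x * F                                         ∎))
        where open ≡-Reasoning

    perfectMatchings-exp-bound : ∀ ε → 0ℚ < ε →
      (1ℚ - 1ℚ * (x * x)) * toℚ (suc k !) - ε ≤ toℚ (numPerfectMatchings H) * expPartial 1 x
    perfectMatchings-exp-bound ε ε>0 = subst₂ _≤_
      (cong (λ c → (1ℚ - c) * toℚ (suc k !) - ε) (sym (*-identityˡ (x * x))))
      (cong (_*_ (toℚ (numPerfectMatchings H))) (sym (expPartial-1 x)))
      (1-x²-bound (nonNegative⁻¹ x {{normalize-nonNeg (numEdges H) (suc k)}}) ε>0 perfectMatchings-ℚ-bound)

open import Defs
open import Data.Nat using (ℕ; _!; NonZero)
open import Data.Nat as N using ()
open import Data.Integer using (+_)
open import Data.Product using (∃-syntax; _,_)
open import Data.Rational using (ℚ; _/_; _-_; _*_; _≤_; _<_; 0ℚ; 1ℚ)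

lemma2 : ∃[ C ] (∀ (m : ℕ) .{{_ : NonZero m}} (H : BipGraph m) → 4 N.* numEdges H N.< m → ∀ (ε : ℚ) → 0ℚ < ε → ∃[ N ] ((1ℚ - C * (((+ numEdges H) / m) * ((+ numEdges H) / m))) * toℚ (m !) - ε ≤ toℚ (numPerfectMatchings H) * expPartial N ((+ numEdges H) / m)))
lemma2 = 1ℚ , λ { (N.suc k) H _ ε ε>0 → 1 , RationalBound.perfectMatchings-exp-bound k H ε ε>0 }
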